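{- Let $r,p$ be positive integers with $r\le 2^p$. Call an $r\times p$ $(0,1)$-matrix SIOR if, reading each row as a binary number, its $i$-th row is strictly less than its $j$-th row whenever $i<j$. Two $(0,1)$-matrices are $P$-equivalent if one can be obtained from the other by a sequence of row permutations, column permutations and column complementations. Let $\Omega_{r,p}=\{[X_1],\dots,[X_k]\}$ be the set of $P$-equivalence classes of SIOR $r\times p$ matrices, where $\sharp[X_i]$ denotes the number of SIOR $r\times p$ matrices in the class of $X_i$. Then $$\sum_{i=1}^{k}\sharp[X_i]=\binom{2^p}{r},\qquad \sharp[X_i]\le 2^p\,p!\ \text{ for all } i,\qquad \sharp\Omega_{r,p}\ge \frac{\binom{2^p}{r}}{2^p\,p!}.$$
   Context: Complementation of a column means changing every entry of that column from $0$ to $1$ and from $1$ to $0$. $\sharp S$ denotes the cardinality of a set $S$. -}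

module Defs where

open import Data.Bool using (Bool; true; false; not)
open import Data.Nat using (ℕ; zero; suc; _+_; _*_; _^_; _<_)
open import Data.Fin using (Fin)
import Data.Fin as F
open import Data.Fin.Permutation using (Permutation′; _⟨$⟩ʳ_)
open import Data.Vec using (Vec; []; _∷_; lookup; tabulate; map; updateAt)
open import Data.List using (List)
open import Data.List.Membership.Propositional using (_∈_)
open import Data.List.Relation.Unary.Unique.Propositional using (Unique)
open import Data.List using (length)
open import Data.Product using (Σ; ∃; _×_)
open import Relation.Binary.PropositionalEquality using (_≡_)
open import Relation.Binary.Construct.Closure.ReflexiveTransitive using (Star)

Matrix : ℕ → ℕ → Set
Matrix r p = Vec (Vec Bool p) r

bit : Bool → ℕ
bit true  = 1
bit false = 0

-- A row read as a binary number; the first entry (column 0) is the most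
-- significant bit.
binVal : {n : ℕ} → Vec Bool n → ℕ
binVal {zero}  []       = 0
binVal {suc n} (b ∷ bs) = bit b * 2 ^ n + binVal bs

SIOR : {r p : ℕ} → Matrix r p → Set
SIOR {r} M = (i j : Fin r) → i F.< j → binVal (lookup M i) < binVal (lookup M j)

data Step {r p : ℕ} (X : Matrix r p) : Matrix r p → Set where
  rowPerm  : (σ : Permutation′ r) →
             Step X (tabulate (λ i → lookup X (σ ⟨$⟩ʳ i)))
  colPerm  : (τ : Permutation′ p) →
             Step X (map (λ row → tabulate (λ j → lookup row (τ ⟨$⟩ʳ j))) X)
  colComp  : (j : Fin p) →
             Step X (map (λ row → updateAt row j not) X)

PEquiv : {r p : ℕ} → Matrix r p → Matrix r p → Set
PEquiv = Star Step

-- ♯ S = n : the set S of matrices has exactly n elements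
-- (there is a duplicate-free list enumerating exactly S, of length n).
HasCard : {r p : ℕ} → (Matrix r p → Set) → ℕ → Set
HasCard {r} {p} S n =
  Σ (List (Matrix r p)) λ xs →
    Unique xs × length xs ≡ n × ((M : Matrix r p) → (M ∈ xs → S M) × (S M → M ∈ xs))

SIORClass : {r p : ℕ} → Matrix r p → Matrix r p → Set
SIORClass X Y = SIOR Y × PEquiv X Y

-- reps : Fin k → Matrix r p lists Ω_{r,p} = {[X_1],…,[X_k]}: each X_i is SIOR,
-- distinct indices give distinct classes, and every SIOR matrix lies in some class.
ClassReps : {r p : ℕ} (k : ℕ) → (Fin k → Matrix r p) → Set
ClassReps {r} {p} k reps =
    ((i : Fin k) → SIOR (reps i))
  × ((i j : Fin k) → PEquiv (reps i) (reps j) → i ≡ j)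
  × ((Y : Matrix r p) → SIOR Y → ∃ λ i → PEquiv (reps i) Y)

module Submission where

-- An SIOR r × p matrix is the same thing as an r-element set of rows of
-- length p, listed in increasing binary value; hence there are (2^p choose r)
-- of them, and the P-classes partition them, which gives the sum formula.
--
-- For the class bound we first normalise P-equivalence: every composite of
-- row permutations, column permutations and column complementations acts as
-- one row permutation followed by one signed column permutation (a column
-- permutation together with a set of complemented columns).  Inside the
-- class of X, an SIOR matrix Y is then determined by its signed column
-- permutation a alone: the rows of Y are the rows of X transformed by a, and
-- a sorted vector is determined by its set of entries.  Signed column
-- permutations are coded injectively by Fin (2^p * p!), which bounds every
-- class.

open import Defs
open import Data.Nat using (ℕ; zero; suc; _+_; _*_; _^_; _≤_; _<_; _!; z≤n; s≤s)
import Data.Nat.Properties as ℕₚ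
open import Data.Nat.Combinatorics using (_C_; nCk+nC[k+1]≡[n+1]C[k+1])
open import Data.Fin as F using (Fin; zero; suc; toℕ; inject₁; punchIn; combine; funToFin; finToFun)
import Data.Fin.Properties as Fₚ
open import Data.Fin.Induction using (<-weakInduction)
open import Data.Fin.Permutation
  using (Permutation′; _⟨$⟩ʳ_; _⟨$⟩ˡ_; inverseˡ; inverseʳ; flip; id; _∘ₚ_; _≈_; remove; insert; insert-remove; insert-punchIn)
open import Data.Bool using (Bool; true; false; not; _xor_)
open import Data.Bool.Properties using (xor-assoc; xor-identityʳ; xor-comm; true-xor; xor-same)
open import Data.Vec using (Vec; []; _∷_; lookup; tabulate; map; updateAt; sum)
import Data.Vec.Properties as Vₚ
open import Data.Vec.Relation.Binary.Pointwise.Extensional using (ext; Pointwise-≡⇒≡)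
open import Data.List as L using (List; []; _∷_; _++_; length)
import Data.List.Properties as Lₚ
open import Data.List.Membership.Propositional using (_∈_)
open import Data.List.Membership.Propositional.Properties using (∈-lookup; ∈-map⁺; ∈-map⁻; ∈-++⁺ˡ; ∈-++⁺ʳ; ∈-++⁻)
open import Data.List.Relation.Unary.Any as Any using (here; there)
open import Data.List.Relation.Unary.Any.Properties using (lookup-index)
import Data.List.Relation.Unary.All as All
import Data.List.Relation.Unary.All.Properties as Allₚ
open import Data.List.Relation.Unary.AllPairs as AllPairs using (AllPairs; []; _∷_)
import Data.List.Relation.Unary.AllPairs.Properties as AllPairsₚ
open import Data.List.Relation.Unary.Unique.Propositional using (Unique)
import Data.List.Relation.Unary.Unique.Propositional.Properties as Uniqueₚ
open import Data.Product using (∃; _×_; _,_; proj₁; proj₂)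
open import Data.Sum using (_⊎_; inj₁; inj₂)
import Data.Sum as Sum
open import Data.Empty using (⊥-elim)
open import Function using (_∘_)
open import Function.Bundles using (Inverse)
open import Relation.Nullary using (¬_; does; yes; no)
open import Relation.Binary.Definitions using (Tri; tri<; tri≈; tri>)
open import Relation.Binary.PropositionalEquality
  using (_≡_; refl; sym; trans; cong; cong₂; subst; subst₂; module ≡-Reasoning)
open import Relation.Binary.Construct.Closure.ReflexiveTransitive using (ε; _◅_; _◅◅_)
import Relation.Binary.Construct.Closure.ReflexiveTransitive as Star

vec-ext : {A : Set} {n : ℕ} {u v : Vec A n} → (∀ i → lookup u i ≡ lookup v i) → u ≡ v
vec-ext u≗v = Pointwise-≡⇒≡ (ext u≗v)

monotone-inflationary : {n : ℕ} (f : Fin n → Fin n) →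
  (∀ i j → i F.< j → f i F.< f j) → ∀ i → i F.≤ f i
monotone-inflationary {suc n} f mono = <-weakInduction (λ i → i F.≤ f i) z≤n step
  where
  -- toℕ i = toℕ (inject₁ i) ≤ f (inject₁ i) < f (suc i)
  step : ∀ i → inject₁ i F.≤ f (inject₁ i) → suc i F.≤ f (suc i)
  step i i≤fi = ℕₚ.≤-<-trans (subst (_≤ toℕ (f (inject₁ i))) (Fₚ.toℕ-inject₁ i) i≤fi)
                             (mono (inject₁ i) (suc i) (Fₚ.≤̄⇒inject₁< ℕₚ.≤-refl))

choose : {A : Set} → List A → (r : ℕ) → List (Vec A r)
choose xs       zero    = [] ∷ []
choose []       (suc r) = []
choose (x ∷ xs) (suc r) = L.map (x ∷_) (choose xs r) ++ choose xs (suc r)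

length-choose : {A : Set} (xs : List A) (r : ℕ) → length (choose xs r) ≡ length xs C r
length-choose xs       zero    = refl
length-choose []       (suc r) = refl
length-choose (x ∷ xs) (suc r) = begin
  length (L.map (x ∷_) (choose xs r) ++ choose xs (suc r))
    ≡⟨ Lₚ.length-++ (L.map (x ∷_) (choose xs r)) ⟩
  length (L.map (x ∷_) (choose xs r)) + length (choose xs (suc r))
    ≡⟨ cong (_+ length (choose xs (suc r))) (Lₚ.length-map (x ∷_) (choose xs r)) ⟩
  length (choose xs r) + length (choose xs (suc r))
    ≡⟨ cong₂ _+_ (length-choose xs r) (length-choose xs (suc r)) ⟩
  length xs C r + length xs C suc r
    ≡⟨ nCk+nC[k+1]≡[n+1]C[k+1] (length xs) r ⟩
  suc (length xs) C suc r ∎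
  where open ≡-Reasoning

∈-choose-∷⁻ : {A : Set} {x : A} {xs : List A} {r : ℕ} {v : Vec A (suc r)} →
  v ∈ choose (x ∷ xs) (suc r) → (∃ λ w → w ∈ choose xs r × v ≡ x ∷ w) ⊎ v ∈ choose xs (suc r)
∈-choose-∷⁻ {x = x} {xs} {r} v∈ = Sum.map₁ (∈-map⁻ (x ∷_)) (∈-++⁻ (L.map (x ∷_) (choose xs r)) v∈)

choose-entries : {A : Set} (xs : List A) (r : ℕ) {v : Vec A r} →
  v ∈ choose xs r → ∀ i → lookup v i ∈ xs
choose-entries (x ∷ xs) (suc r) v∈ i with ∈-choose-∷⁻ v∈
choose-entries (x ∷ xs) (suc r) v∈ zero    | inj₁ (w , w∈ , refl) = here refl
choose-entries (x ∷ xs) (suc r) v∈ (suc i) | inj₁ (w , w∈ , refl) = there (choose-entries xs r w∈ i)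
choose-entries (x ∷ xs) (suc r) v∈ i       | inj₂ v∈′            = there (choose-entries xs (suc r) v∈′ i)

choose-unique : {A : Set} {xs : List A} (r : ℕ) → Unique xs → Unique (choose xs r)
choose-unique zero _ = All.[] ∷ []
choose-unique {xs = []} (suc r) _ = []
choose-unique {xs = x ∷ xs} (suc r) (x∉xs ∷ u) =
  Uniqueₚ.++⁺ (Uniqueₚ.map⁺ Vₚ.∷-injectiveʳ (choose-unique r u)) (choose-unique (suc r) u) disjoint
  where
  -- a selection from xs never starts with x
  disjoint : ∀ {v} → ¬ (v ∈ L.map (x ∷_) (choose xs r) × v ∈ choose xs (suc r))
  disjoint (v∈₁ , v∈₂) with ∈-map⁻ (x ∷_) v∈₁
  ... | _ , _ , refl = All.lookup x∉xs (choose-entries xs (suc r) v∈₂ zero) refl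

module SortedByKey {A : Set} (key : A → ℕ) where

  -- Entries have strictly increasing keys; SIOR is `Sorted binVal`.
  Sorted : {n : ℕ} → Vec A n → Set
  Sorted {n} v = (i j : Fin n) → i F.< j → key (lookup v i) < key (lookup v j)

  StrictlySorted : List A → Set
  StrictlySorted = AllPairs (λ x y → key x < key y)

  sorted⇒unique : {xs : List A} → StrictlySorted xs → Unique xs
  sorted⇒unique = AllPairs.map (λ x<y x≡y → ℕₚ.<-irrefl (cong key x≡y) x<y)

  sorted-∷ : {n : ℕ} {x : A} {v : Vec A n} →
    (∀ j → key x < key (lookup v j)) → Sorted v → Sorted (x ∷ v)
  sorted-∷ x<v sv zero    (suc j) _         = x<v j
  sorted-∷ x<v sv (suc i) (suc j) (s≤s i<j) = sv i j i<j

  sorted-head : {n : ℕ} {x : A} {v : Vec A n} → Sorted (x ∷ v) → ∀ j → key x < key (lookup v j)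
  sorted-head s j = s zero (suc j) (s≤s z≤n)

  sorted-tail : {n : ℕ} {x : A} {v : Vec A n} → Sorted (x ∷ v) → Sorted v
  sorted-tail s i j i<j = s (suc i) (suc j) (s≤s i<j)

  reindex-monotone : {n : ℕ} {v w : Vec A n} (f : Fin n → Fin n) → Sorted v → Sorted w →
    (∀ i → lookup w i ≡ lookup v (f i)) → ∀ i j → i F.< j → f i F.< f j
  reindex-monotone {v = v} {w} f sv sw w≡v∘f i j i<j = compare (Fₚ.<-cmp (f i) (f j))
    where
    vfi<vfj : key (lookup v (f i)) < key (lookup v (f j))
    vfi<vfj = subst₂ (λ a b → key a < key b) (w≡v∘f i) (w≡v∘f j) (sw i j i<j)
    compare : Tri (f i F.< f j) (f i ≡ f j) (f j F.< f i) → f i F.< f j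
    compare (tri< fi<fj _ _) = fi<fj
    compare (tri≈ _ fi≡fj _) = ⊥-elim (ℕₚ.<-irrefl (cong (key ∘ lookup v) fi≡fj) vfi<vfj)
    compare (tri> _ _ fj<fi) = ⊥-elim (ℕₚ.<-asym vfi<vfj (sv (f j) (f i) fj<fi))

  sorted-rearrangement : {n : ℕ} {v w : Vec A n} (ρ : Permutation′ n) → Sorted v → Sorted w →
    (∀ i → lookup w i ≡ lookup v (ρ ⟨$⟩ʳ i)) → w ≡ v
  sorted-rearrangement {v = v} {w} ρ sv sw w≡vρ = vec-ext (λ i → trans (w≡vρ i) (cong (lookup v) (ρ-fixes i)))
    where
    v≡wρ⁻¹ : ∀ i → lookup v i ≡ lookup w (ρ ⟨$⟩ˡ i)
    v≡wρ⁻¹ i = trans (cong (lookup v) (sym (inverseʳ ρ))) (sym (w≡vρ (ρ ⟨$⟩ˡ i)))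
    ρ-up : ∀ i → i F.≤ ρ ⟨$⟩ʳ i
    ρ-up = monotone-inflationary (ρ ⟨$⟩ʳ_) (reindex-monotone {v = v} {w} (ρ ⟨$⟩ʳ_) sv sw w≡vρ)
    ρ⁻¹-up : ∀ i → i F.≤ ρ ⟨$⟩ˡ i
    ρ⁻¹-up = monotone-inflationary (ρ ⟨$⟩ˡ_) (reindex-monotone {v = w} {v} (ρ ⟨$⟩ˡ_) sw sv v≡wρ⁻¹)
    ρ-fixes : ∀ i → ρ ⟨$⟩ʳ i ≡ i
    ρ-fixes i = Fₚ.≤-antisym (subst (ρ ⟨$⟩ʳ i F.≤_) (inverseˡ ρ) (ρ⁻¹-up (ρ ⟨$⟩ʳ i))) (ρ-up i)

  choose-sorted : {xs : List A} {r : ℕ} {v : Vec A r} → StrictlySorted xs → v ∈ choose xs r → Sorted v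
  choose-sorted {r = zero} _ (here refl) ()
  choose-sorted {xs = x ∷ xs} {suc r} (x< ∷ s) v∈ with ∈-choose-∷⁻ v∈
  ... | inj₁ (w , w∈ , refl) = sorted-∷ (λ j → All.lookup x< (choose-entries xs r w∈ j)) (choose-sorted s w∈)
  ... | inj₂ v∈′ = choose-sorted s v∈′

  choose-complete : {xs : List A} {r : ℕ} {v : Vec A r} → StrictlySorted xs → Sorted v →
    (∀ i → lookup v i ∈ xs) → v ∈ choose xs r
  choose-complete {v = []} _ _ _ = here refl
  choose-complete {xs = []} {v = u ∷ w} _ _ v⊆ with v⊆ zero
  ... | ()
  choose-complete {xs = x ∷ xs} {v = u ∷ w} (x< ∷ s) sv v⊆ with v⊆ zero
  ... | here refl = ∈-++⁺ˡ (∈-map⁺ (x ∷_) (choose-complete s (sorted-tail sv) w⊆xs))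
    where
    -- the later entries exceed u = x, so they are not x
    w⊆xs : ∀ i → lookup w i ∈ xs
    w⊆xs i with v⊆ (suc i)
    ... | here wᵢ≡x = ⊥-elim (ℕₚ.<-irrefl (cong key (sym wᵢ≡x)) (sorted-head sv i))
    ... | there wᵢ∈ = wᵢ∈
  ... | there u∈ = ∈-++⁺ʳ _ (choose-complete s sv v⊆xs)
    where
    -- x is below u, which is below every later entry
    v⊆xs : ∀ i → lookup (u ∷ w) i ∈ xs
    v⊆xs zero = u∈
    v⊆xs (suc i) with v⊆ (suc i)
    ... | here wᵢ≡x = ⊥-elim (ℕₚ.<-asym (All.lookup x< u∈) (subst (λ y → key u < key y) wᵢ≡x (sorted-head sv i)))
    ... | there wᵢ∈ = wᵢ∈

module RowOrder {p : ℕ} = SortedByKey (binVal {p})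
open RowOrder using (StrictlySorted; sorted⇒unique; sorted-rearrangement; choose-sorted; choose-complete)

allRows : (p : ℕ) → List (Vec Bool p)
allRows zero    = [] ∷ []
allRows (suc p) = L.map (false ∷_) (allRows p) ++ L.map (true ∷_) (allRows p)

length-allRows : (p : ℕ) → length (allRows p) ≡ 2 ^ p
length-allRows zero    = refl
length-allRows (suc p) = begin
  length (L.map (false ∷_) (allRows p) ++ L.map (true ∷_) (allRows p))
    ≡⟨ Lₚ.length-++ (L.map (false ∷_) (allRows p)) ⟩
  length (L.map (false ∷_) (allRows p)) + length (L.map (true ∷_) (allRows p))
    ≡⟨ cong₂ _+_ (Lₚ.length-map (false ∷_) (allRows p)) (Lₚ.length-map (true ∷_) (allRows p)) ⟩
  length (allRows p) + length (allRows p)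
    ≡⟨ cong₂ _+_ (length-allRows p) (trans (length-allRows p) (sym (ℕₚ.+-identityʳ (2 ^ p)))) ⟩
  2 ^ suc p ∎
  where open ≡-Reasoning

allRows-complete : {p : ℕ} (v : Vec Bool p) → v ∈ allRows p
allRows-complete []          = here refl
allRows-complete (false ∷ u) = ∈-++⁺ˡ (∈-map⁺ (false ∷_) (allRows-complete u))
allRows-complete {suc p} (true ∷ u) =
  ∈-++⁺ʳ (L.map (false ∷_) (allRows p)) (∈-map⁺ (true ∷_) (allRows-complete u))

binVal-bound : {p : ℕ} (v : Vec Bool p) → binVal v < 2 ^ p
binVal-bound []               = s≤s z≤n
binVal-bound {suc p} (b ∷ u) =
  subst (binVal (b ∷ u) <_) (cong (2 ^ p +_) (sym (ℕₚ.+-identityʳ (2 ^ p))))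
        (ℕₚ.+-mono-≤-< (leading b) (binVal-bound u))
  where
  leading : ∀ b → bit b * 2 ^ p ≤ 2 ^ p
  leading false = z≤n
  leading true  = ℕₚ.≤-reflexive (ℕₚ.+-identityʳ (2 ^ p))

-- The rows starting with 0 come before those starting with 1, each block sorted.
allRows-sorted : (p : ℕ) → StrictlySorted (allRows p)
allRows-sorted zero    = All.[] ∷ []
allRows-sorted (suc p) = AllPairsₚ.++⁺
  (AllPairsₚ.map⁺ (allRows-sorted p))
  (AllPairsₚ.map⁺ (AllPairs.map (ℕₚ.+-monoʳ-< (2 ^ p + 0)) (allRows-sorted p)))
  (Allₚ.map⁺ (All.universal (λ u → Allₚ.map⁺ (All.universal (λ w → zero-block<one-block u w) _)) _))
  where
  zero-block<one-block : ∀ u w → binVal (false ∷ u) < binVal (true ∷ w)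
  zero-block<one-block u w =
    ℕₚ.<-≤-trans (binVal-bound u) (ℕₚ.≤-trans (ℕₚ.m≤m+n (2 ^ p) 0) (ℕₚ.m≤m+n (2 ^ p + 0) (binVal w)))

sior-count : (r p : ℕ) → HasCard (SIOR {r} {p}) (2 ^ p C r)
sior-count r p =
  choose (allRows p) r ,
  choose-unique r (sorted⇒unique (allRows-sorted p)) ,
  trans (length-choose (allRows p) r) (cong (_C r) (length-allRows p)) ,
  λ M → choose-sorted (allRows-sorted p) ,
        λ sM → choose-complete (allRows-sorted p) sM (λ i → allRows-complete (lookup M i))

-- Permute the columns by `perm`, then complement the columns where `sign` holds.
record SignedPerm (p : ℕ) : Set where
  field
    perm : Permutation′ p
    sign : Fin p → Bool
open SignedPerm

apply : {p : ℕ} → SignedPerm p → Vec Bool p → Vec Bool p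
apply a v = tabulate (λ j → lookup v (perm a ⟨$⟩ʳ j) xor sign a j)

lookup-apply : {p : ℕ} (a : SignedPerm p) (v : Vec Bool p) (j : Fin p) →
  lookup (apply a v) j ≡ lookup v (perm a ⟨$⟩ʳ j) xor sign a j
lookup-apply a v = Vₚ.lookup∘tabulate _

unsigned : {p : ℕ} → Permutation′ p → SignedPerm p
unsigned τ = record { perm = τ ; sign = λ _ → false }

apply-unsigned : {p : ℕ} (τ : Permutation′ p) (v : Vec Bool p) →
  apply (unsigned τ) v ≡ tabulate (λ j → lookup v (τ ⟨$⟩ʳ j))
apply-unsigned τ v = Vₚ.tabulate-cong (λ j → xor-identityʳ _)

apply-id : {p : ℕ} (v : Vec Bool p) → apply (unsigned id) v ≡ v
apply-id v = trans (apply-unsigned id v) (Vₚ.tabulate∘lookup v)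

_⊙_ : {p : ℕ} → SignedPerm p → SignedPerm p → SignedPerm p
b ⊙ a = record { perm = perm b ∘ₚ perm a ; sign = λ j → sign a (perm b ⟨$⟩ʳ j) xor sign b j }

apply-⊙ : {p : ℕ} (b a : SignedPerm p) (v : Vec Bool p) → apply b (apply a v) ≡ apply (b ⊙ a) v
apply-⊙ b a v = vec-ext λ j → begin
  lookup (apply b (apply a v)) j
    ≡⟨ lookup-apply b (apply a v) j ⟩
  lookup (apply a v) (perm b ⟨$⟩ʳ j) xor sign b j
    ≡⟨ cong (_xor sign b j) (lookup-apply a v (perm b ⟨$⟩ʳ j)) ⟩
  (lookup v (perm a ⟨$⟩ʳ (perm b ⟨$⟩ʳ j)) xor sign a (perm b ⟨$⟩ʳ j)) xor sign b j
    ≡⟨ xor-assoc (lookup v (perm a ⟨$⟩ʳ (perm b ⟨$⟩ʳ j))) (sign a (perm b ⟨$⟩ʳ j)) (sign b j) ⟩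
  lookup v (perm a ⟨$⟩ʳ (perm b ⟨$⟩ʳ j)) xor (sign a (perm b ⟨$⟩ʳ j) xor sign b j)
    ≡⟨ sym (lookup-apply (b ⊙ a) v j) ⟩
  lookup (apply (b ⊙ a) v) j ∎
  where open ≡-Reasoning

-- Permutations of Fin n are coded injectively in Fin (n !): record the image
-- of 0, then code the permutation with 0 removed.
permCode : {n : ℕ} → Permutation′ n → Fin (n !)
permCode {zero}  π = zero
permCode {suc n} π = combine (π ⟨$⟩ʳ zero) (permCode (remove zero π))

permCode-injective : {n : ℕ} {π ρ : Permutation′ n} → permCode π ≡ permCode ρ → π ≈ ρ
permCode-injective {suc n} {π} {ρ} eq zero    = proj₁ (Fₚ.combine-injective _ _ _ _ eq)
permCode-injective {suc n} {π} {ρ} eq (suc i) = begin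
  π ⟨$⟩ʳ suc i
    ≡⟨ sym (insert-remove zero π (suc i)) ⟩
  insert zero (π ⟨$⟩ʳ zero) (remove zero π) ⟨$⟩ʳ punchIn zero i
    ≡⟨ insert-punchIn zero (π ⟨$⟩ʳ zero) (remove zero π) i ⟩
  punchIn (π ⟨$⟩ʳ zero) (remove zero π ⟨$⟩ʳ i)
    ≡⟨ cong₂ punchIn (proj₁ heads-tails) (permCode-injective (proj₂ heads-tails) i) ⟩
  punchIn (ρ ⟨$⟩ʳ zero) (remove zero ρ ⟨$⟩ʳ i)
    ≡⟨ sym (insert-punchIn zero (ρ ⟨$⟩ʳ zero) (remove zero ρ) i) ⟩
  insert zero (ρ ⟨$⟩ʳ zero) (remove zero ρ) ⟨$⟩ʳ punchIn zero i
    ≡⟨ insert-remove zero ρ (suc i) ⟩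
  ρ ⟨$⟩ʳ suc i ∎
  where
  open ≡-Reasoning
  heads-tails : π ⟨$⟩ʳ zero ≡ ρ ⟨$⟩ʳ zero × permCode (remove zero π) ≡ permCode (remove zero ρ)
  heads-tails = Fₚ.combine-injective _ _ _ _ eq

module BoolAsFin = Inverse Fₚ.2↔Bool

signCode : {p : ℕ} → (Fin p → Bool) → Fin (2 ^ p)
signCode c = funToFin (BoolAsFin.from ∘ c)

signCode-injective : {p : ℕ} {c d : Fin p → Bool} → signCode c ≡ signCode d → ∀ j → c j ≡ d j
signCode-injective {c = c} {d} eq j = begin
  c j                                     ≡⟨ sym (BoolAsFin.strictlyInverseˡ (c j)) ⟩
  BoolAsFin.to (BoolAsFin.from (c j))     ≡⟨ cong BoolAsFin.to (sym (Fₚ.finToFun-funToFin _ j)) ⟩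
  BoolAsFin.to (finToFun (signCode c) j)  ≡⟨ cong (λ k → BoolAsFin.to (finToFun k j)) eq ⟩
  BoolAsFin.to (finToFun (signCode d) j)  ≡⟨ cong BoolAsFin.to (Fₚ.finToFun-funToFin _ j) ⟩
  BoolAsFin.to (BoolAsFin.from (d j))     ≡⟨ BoolAsFin.strictlyInverseˡ (d j) ⟩
  d j ∎
  where open ≡-Reasoning

signedPermCode : {p : ℕ} → SignedPerm p → Fin (2 ^ p * p !)
signedPermCode a = combine (signCode (sign a)) (permCode (perm a))

signedPermCode-injective : {p : ℕ} (a b : SignedPerm p) →
  signedPermCode a ≡ signedPermCode b → ∀ v → apply a v ≡ apply b v
signedPermCode-injective a b eq v = vec-ext λ j → begin
  lookup (apply a v) j                        ≡⟨ lookup-apply a v j ⟩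
  lookup v (perm a ⟨$⟩ʳ j) xor sign a j       ≡⟨ cong₂ (λ k s → lookup v k xor s) (same-perm j) (same-sign j) ⟩
  lookup v (perm b ⟨$⟩ʳ j) xor sign b j       ≡⟨ sym (lookup-apply b v j) ⟩
  lookup (apply b v) j ∎
  where
  open ≡-Reasoning
  codes : signCode (sign a) ≡ signCode (sign b) × permCode (perm a) ≡ permCode (perm b)
  codes = Fₚ.combine-injective _ _ _ _ eq
  same-sign : ∀ j → sign a j ≡ sign b j
  same-sign = signCode-injective (proj₁ codes)
  same-perm : perm a ≈ perm b
  same-perm = permCode-injective (proj₂ codes)

record NormalForm {r p : ℕ} (X Y : Matrix r p) : Set where
  field
    cols : SignedPerm p
    rows : Permutation′ r
    rowwise : ∀ i → lookup Y i ≡ apply cols (lookup X (rows ⟨$⟩ʳ i))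
open NormalForm

lookup-complement : {p : ℕ} (row : Vec Bool p) (j k : Fin p) →
  lookup (updateAt row j not) k ≡ lookup row k xor does (j F.≟ k)
lookup-complement row j k with j F.≟ k
... | yes refl = trans (Vₚ.lookup∘updateAt j row) (trans (sym (true-xor _)) (xor-comm true _))
... | no j≢k   = trans (Vₚ.lookup∘updateAt′ k j (j≢k ∘ sym) row) (sym (xor-identityʳ _))

step-normalForm : {r p : ℕ} {X Y : Matrix r p} → Step X Y → NormalForm X Y
step-normalForm (rowPerm σ) = record
  { cols = unsigned id ; rows = σ
  ; rowwise = λ i → trans (Vₚ.lookup∘tabulate _ i) (sym (apply-id _)) }
step-normalForm {X = X} (colPerm τ) = record
  { cols = unsigned τ ; rows = id
  ; rowwise = λ i → trans (Vₚ.lookup-map i _ X) (sym (apply-unsigned τ (lookup X i))) }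
step-normalForm {p = p} {X = X} (colComp j) = record
  { cols = complement ; rows = id
  ; rowwise = λ i → trans (Vₚ.lookup-map i _ X)
      (vec-ext λ k → trans (lookup-complement (lookup X i) j k) (sym (lookup-apply complement (lookup X i) k))) }
  where
  complement : SignedPerm p
  complement = record { perm = id ; sign = λ k → does (j F.≟ k) }

normalForm-trans : {r p : ℕ} {X Y Z : Matrix r p} → NormalForm X Y → NormalForm Y Z → NormalForm X Z
normalForm-trans {X = X} {Y} {Z} f g = record
  { cols = cols g ⊙ cols f ; rows = rows g ∘ₚ rows f
  ; rowwise = λ i → begin
      lookup Z i
        ≡⟨ rowwise g i ⟩
      apply (cols g) (lookup Y (rows g ⟨$⟩ʳ i))
        ≡⟨ cong (apply (cols g)) (rowwise f (rows g ⟨$⟩ʳ i)) ⟩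
      apply (cols g) (apply (cols f) (lookup X (rows f ⟨$⟩ʳ (rows g ⟨$⟩ʳ i))))
        ≡⟨ apply-⊙ (cols g) (cols f) (lookup X (rows f ⟨$⟩ʳ (rows g ⟨$⟩ʳ i))) ⟩
      apply (cols g ⊙ cols f) (lookup X (rows f ⟨$⟩ʳ (rows g ⟨$⟩ʳ i))) ∎ }
  where open ≡-Reasoning

normalForm : {r p : ℕ} {X Y : Matrix r p} → PEquiv X Y → NormalForm X Y
normalForm ε = record { cols = unsigned id ; rows = id ; rowwise = λ i → sym (apply-id _) }
normalForm (s ◅ path) = normalForm-trans (step-normalForm s) (normalForm path)

map-inverse : {A : Set} {n : ℕ} {f g : A → A} → (∀ x → g (f x) ≡ x) → (xs : Vec A n) → map g (map f xs) ≡ xs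
map-inverse {f = f} {g} g∘f≗id xs = trans (sym (Vₚ.map-∘ g f xs)) (trans (Vₚ.map-cong g∘f≗id xs) (Vₚ.map-id xs))

step-sym : {r p : ℕ} {X Y : Matrix r p} → Step X Y → Step Y X
step-sym {X = X} (rowPerm σ) = subst (Step _) undo (rowPerm (flip σ))
  where
  undo : tabulate (λ i → lookup (tabulate (λ i → lookup X (σ ⟨$⟩ʳ i))) (σ ⟨$⟩ˡ i)) ≡ X
  undo = vec-ext λ i → trans (Vₚ.lookup∘tabulate _ i)
                         (trans (Vₚ.lookup∘tabulate _ (σ ⟨$⟩ˡ i)) (cong (lookup X) (inverseʳ σ)))
step-sym {p = p} {X = X} (colPerm τ) = subst (Step _) undo (colPerm (flip τ))
  where
  permuteCols : Permutation′ p → Vec Bool p → Vec Bool p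
  permuteCols t row = tabulate (λ j → lookup row (t ⟨$⟩ʳ j))
  undoRow : ∀ row → permuteCols (flip τ) (permuteCols τ row) ≡ row
  undoRow row = vec-ext λ k → trans (Vₚ.lookup∘tabulate _ k)
                  (trans (Vₚ.lookup∘tabulate _ (τ ⟨$⟩ˡ k)) (cong (lookup row) (inverseʳ τ)))
  undo : map (permuteCols (flip τ)) (map (permuteCols τ) X) ≡ X
  undo = map-inverse undoRow X
step-sym {p = p} {X = X} (colComp j) = subst (Step _) undo (colComp j)
  where
  complement : Vec Bool p → Vec Bool p
  complement row = updateAt row j not
  undoRow : ∀ row → complement (complement row) ≡ row
  undoRow row = vec-ext λ k → begin
    lookup (complement (complement row)) k
      ≡⟨ lookup-complement (complement row) j k ⟩
    lookup (complement row) k xor does (j F.≟ k)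
      ≡⟨ cong (_xor does (j F.≟ k)) (lookup-complement row j k) ⟩
    (lookup row k xor does (j F.≟ k)) xor does (j F.≟ k)
      ≡⟨ xor-assoc (lookup row k) (does (j F.≟ k)) (does (j F.≟ k)) ⟩
    lookup row k xor (does (j F.≟ k) xor does (j F.≟ k))
      ≡⟨ cong (lookup row k xor_) (xor-same (does (j F.≟ k))) ⟩
    lookup row k xor false
      ≡⟨ xor-identityʳ _ ⟩
    lookup row k ∎
    where open ≡-Reasoning
  undo : map complement (map complement X) ≡ X
  undo = map-inverse undoRow X

PEquiv-sym : {r p : ℕ} {X Y : Matrix r p} → PEquiv X Y → PEquiv Y X
PEquiv-sym = Star.reverse step-sym

-- Within a P-class, an SIOR matrix is determined by the action of its
-- signed column permutation: both matrices are sorted rearrangements of the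
-- same transformed rows of X.
sior-determined : {r p : ℕ} {X Y Y′ : Matrix r p} → SIOR Y → SIOR Y′ →
  (f : NormalForm X Y) (g : NormalForm X Y′) → (∀ v → apply (cols f) v ≡ apply (cols g) v) → Y ≡ Y′
sior-determined {X = X} {Y} {Y′} sY sY′ f g same =
  sym (sorted-rearrangement (rows g ∘ₚ flip (rows f)) sY sY′ Y′≡Yρ)
  where
  open ≡-Reasoning
  Y′≡Yρ : ∀ i → lookup Y′ i ≡ lookup Y (rows f ⟨$⟩ˡ (rows g ⟨$⟩ʳ i))
  Y′≡Yρ i = begin
    lookup Y′ i                                                  ≡⟨ rowwise g i ⟩
    apply (cols g) (lookup X (rows g ⟨$⟩ʳ i))                    ≡⟨ sym (same (lookup X (rows g ⟨$⟩ʳ i))) ⟩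
    apply (cols f) (lookup X (rows g ⟨$⟩ʳ i))                    ≡⟨ cong (apply (cols f) ∘ lookup X) (sym (inverseʳ (rows f))) ⟩
    apply (cols f) (lookup X (rows f ⟨$⟩ʳ (rows f ⟨$⟩ˡ (rows g ⟨$⟩ʳ i)))) ≡⟨ sym (rowwise f (rows f ⟨$⟩ˡ (rows g ⟨$⟩ʳ i))) ⟩
    lookup Y (rows f ⟨$⟩ˡ (rows g ⟨$⟩ʳ i)) ∎

unique-lookup-injective : {A : Set} {xs : List A} → Unique xs →
  ∀ {i j} → L.lookup xs i ≡ L.lookup xs j → i ≡ j
unique-lookup-injective (x∉ ∷ u) {zero}  {zero}  eq = refl
unique-lookup-injective (x∉ ∷ u) {zero}  {suc j} eq = ⊥-elim (All.lookup x∉ (∈-lookup j) eq)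
unique-lookup-injective (x∉ ∷ u) {suc i} {zero}  eq = ⊥-elim (All.lookup x∉ (∈-lookup i) (sym eq))
unique-lookup-injective (x∉ ∷ u) {suc i} {suc j} eq = cong suc (unique-lookup-injective u eq)

unique-code-bound : {A : Set} {xs : List A} {N : ℕ} → Unique xs →
  (code : ∀ {x} → x ∈ xs → Fin N) →
  (∀ {x y} (x∈ : x ∈ xs) (y∈ : y ∈ xs) → code x∈ ≡ code y∈ → x ≡ y) → length xs ≤ N
unique-code-bound {xs = xs} u code injective =
  Fₚ.injective⇒≤ {f = λ i → code (∈-lookup {xs = xs} i)} (unique-lookup-injective u ∘ injective _ _)

unique-⊆-bound : {A : Set} {xs ys : List A} → Unique xs → (∀ {x} → x ∈ xs → x ∈ ys) → length xs ≤ length ys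
unique-⊆-bound {ys = ys} u xs⊆ys = unique-code-bound u (Any.index ∘ xs⊆ys)
  (λ x∈ y∈ eq → trans (lookup-index (xs⊆ys x∈)) (trans (cong (L.lookup ys) eq) (sym (lookup-index (xs⊆ys y∈)))))

concatFin : {A : Set} (k : ℕ) → (Fin k → List A) → List A
concatFin zero    xs = []
concatFin (suc k) xs = xs zero ++ concatFin k (xs ∘ suc)

∈-concatFin⁺ : {A : Set} (k : ℕ) (xs : Fin k → List A) {x : A} (i : Fin k) → x ∈ xs i → x ∈ concatFin k xs
∈-concatFin⁺ (suc k) xs zero    x∈ = ∈-++⁺ˡ x∈
∈-concatFin⁺ (suc k) xs (suc i) x∈ = ∈-++⁺ʳ (xs zero) (∈-concatFin⁺ k (xs ∘ suc) i x∈)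

∈-concatFin⁻ : {A : Set} (k : ℕ) (xs : Fin k → List A) {x : A} → x ∈ concatFin k xs → ∃ λ i → x ∈ xs i
∈-concatFin⁻ (suc k) xs x∈ with ∈-++⁻ (xs zero) x∈
... | inj₁ x∈₀ = zero , x∈₀
... | inj₂ x∈ᵣ = let i , x∈ᵢ = ∈-concatFin⁻ k (xs ∘ suc) x∈ᵣ in suc i , x∈ᵢ

length-concatFin : {A : Set} (k : ℕ) (xs : Fin k → List A) → length (concatFin k xs) ≡ sum (tabulate (length ∘ xs))
length-concatFin zero    xs = refl
length-concatFin (suc k) xs = trans (Lₚ.length-++ (xs zero)) (cong (length (xs zero) +_) (length-concatFin k (xs ∘ suc)))

unique-concatFin : {A : Set} (k : ℕ) (xs : Fin k → List A) → (∀ i → Unique (xs i)) →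
  (∀ i j {x} → x ∈ xs i → x ∈ xs j → i ≡ j) → Unique (concatFin k xs)
unique-concatFin zero    xs u disjoint = []
unique-concatFin (suc k) xs u disjoint =
  Uniqueₚ.++⁺ (u zero) (unique-concatFin k (xs ∘ suc) (u ∘ suc) disjointₛ) first-vs-rest
  where
  disjointₛ : ∀ i j {x} → x ∈ xs (suc i) → x ∈ xs (suc j) → i ≡ j
  disjointₛ i j x∈ x∈′ = Fₚ.suc-injective (disjoint (suc i) (suc j) x∈ x∈′)
  first-vs-rest : ∀ {x} → ¬ (x ∈ xs zero × x ∈ concatFin k (xs ∘ suc))
  first-vs-rest (x∈₀ , x∈ᵣ) with ∈-concatFin⁻ k (xs ∘ suc) x∈ᵣ
  ... | j , x∈ⱼ with disjoint zero (suc j) x∈₀ x∈ⱼ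
  ... | ()

partition-length : {A : Set} {ys : List A} (k : ℕ) (xs : Fin k → List A) → Unique ys → (∀ i → Unique (xs i)) →
  (∀ i j {x} → x ∈ xs i → x ∈ xs j → i ≡ j) →
  (∀ i {x} → x ∈ xs i → x ∈ ys) → (∀ {x} → x ∈ ys → ∃ λ i → x ∈ xs i) →
  sum (tabulate (length ∘ xs)) ≡ length ys
partition-length k xs uys uxs disjoint inside cover = trans (sym (length-concatFin k xs)) (ℕₚ.≤-antisym
  (unique-⊆-bound (unique-concatFin k xs uxs disjoint) (λ x∈ → let i , x∈ᵢ = ∈-concatFin⁻ k xs x∈ in inside i x∈ᵢ))
  (unique-⊆-bound uys (λ x∈ → let i , x∈ᵢ = cover x∈ in ∈-concatFin⁺ k xs i x∈ᵢ)))

sum-bound : (k : ℕ) (s : Fin k → ℕ) (B : ℕ) → (∀ i → s i ≤ B) → sum (tabulate s) ≤ k * B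
sum-bound zero    s B s≤B = z≤n
sum-bound (suc k) s B s≤B = ℕₚ.+-mono-≤ (s≤B zero) (sum-bound k (s ∘ suc) B (s≤B ∘ suc))

class-size-bound : {r p n : ℕ} (X : Matrix r p) → HasCard (SIORClass X) n → n ≤ 2 ^ p * p !
class-size-bound {p = p} X (xs , unique , refl , member) = unique-code-bound unique code injective
  where
  inClass : ∀ {Y} → Y ∈ xs → SIORClass X Y
  inClass {Y} = proj₁ (member Y)
  normal : ∀ {Y} → Y ∈ xs → NormalForm X Y
  normal Y∈ = normalForm (proj₂ (inClass Y∈))
  code : ∀ {Y} → Y ∈ xs → Fin (2 ^ p * p !)
  code Y∈ = signedPermCode (cols (normal Y∈))
  injective : ∀ {Y Y′} (Y∈ : Y ∈ xs) (Y′∈ : Y′ ∈ xs) → code Y∈ ≡ code Y′∈ → Y ≡ Y′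
  injective Y∈ Y′∈ eq = sior-determined (proj₁ (inClass Y∈)) (proj₁ (inClass Y′∈)) (normal Y∈) (normal Y′∈)
    (signedPermCode-injective (cols (normal Y∈)) (cols (normal Y′∈)) eq)

classes-partition : {r p k : ℕ} (reps : Fin k → Matrix r p) → ClassReps k reps →
  (size : Fin k → ℕ) → (∀ i → HasCard (SIORClass (reps i)) (size i)) → sum (tabulate size) ≡ 2 ^ p C r
classes-partition {r} {p} {k} reps (_ , distinct , covered) size cards with sior-count r p
... | all , uniqueAll , lengthAll , memberAll = begin
  sum (tabulate size)            ≡⟨ cong sum (Vₚ.tabulate-cong (sym ∘ lengthOf)) ⟩
  sum (tabulate (length ∘ xs))   ≡⟨ partition-length k xs uniqueAll uniqueOf disjoint inside cover ⟩
  length all                     ≡⟨ lengthAll ⟩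
  2 ^ p C r ∎
  where
  open ≡-Reasoning
  xs : Fin k → List (Matrix r p)
  xs i = proj₁ (cards i)
  uniqueOf : ∀ i → Unique (xs i)
  uniqueOf i = proj₁ (proj₂ (cards i))
  lengthOf : ∀ i → length (xs i) ≡ size i
  lengthOf i = proj₁ (proj₂ (proj₂ (cards i)))
  inClass : ∀ i {Y} → Y ∈ xs i → SIORClass (reps i) Y
  inClass i {Y} = proj₁ (proj₂ (proj₂ (proj₂ (cards i))) Y)
  disjoint : ∀ i j {Y} → Y ∈ xs i → Y ∈ xs j → i ≡ j
  disjoint i j Y∈ᵢ Y∈ⱼ = distinct i j (proj₂ (inClass i Y∈ᵢ) ◅◅ PEquiv-sym (proj₂ (inClass j Y∈ⱼ)))
  inside : ∀ i {Y} → Y ∈ xs i → Y ∈ all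
  inside i {Y} Y∈ = proj₂ (memberAll Y) (proj₁ (inClass i Y∈))
  cover : ∀ {Y} → Y ∈ all → ∃ λ i → Y ∈ xs i
  cover {Y} Y∈ with covered Y (proj₁ (memberAll Y) Y∈)
  ... | i , repᵢ~Y = i , proj₂ (proj₂ (proj₂ (proj₂ (cards i))) Y) (proj₁ (memberAll Y) Y∈ , repᵢ~Y)

proposition2 : (r p : ℕ) → 1 ≤ r → 1 ≤ p → r ≤ 2 ^ p →
    (k : ℕ) (reps : Fin k → Matrix r p) → ClassReps k reps →
    (size : Fin k → ℕ) → ((i : Fin k) → HasCard (SIORClass (reps i)) (size i)) →
      (sum (tabulate size) ≡ (2 ^ p) C r)
      × ((i : Fin k) → size i ≤ 2 ^ p * p !)
      × ((2 ^ p) C r ≤ k * (2 ^ p * p !))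
proposition2 r p _ _ _ k reps classReps size cards = total , classBound , classCount
  where
  total : sum (tabulate size) ≡ 2 ^ p C r
  total = classes-partition reps classReps size cards
  classBound : (i : Fin k) → size i ≤ 2 ^ p * p !
  classBound i = class-size-bound (reps i) (cards i)
  classCount : 2 ^ p C r ≤ k * (2 ^ p * p !)
  classCount = subst (_≤ k * (2 ^ p * p !)) total (sum-bound k size (2 ^ p * p !) classBound)
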